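{- Let $\mathcal{K}$ be a discrete valued field with finite residue field $\mathbb{F}_q$, and let $2\le\ell\le n$. Then the sequence $(\Theta_n^{(k,\ell)})_{k\ge\ell}$ is strictly increasing in $k$.
   Context: The absolute value on $\mathcal{K}$ is $|\lambda|=q^{ -\nu(\lambda)}$ for the valuation $\nu$, and $\mathcal{K}^n$ carries the norm $\Vert\mathbf{v}\Vert=\max_i|v_i|$; $\mathbb{B}_n=\{\mathbf{v}\in\mathcal{K}^n:\Vert\mathbf{v}\Vert=1\}$. Nonzero vectors $\mathbf{u}_1,\dots,\mathbf{u}_\ell$ are orthogonal if $\Vert\sum_i\lambda_i\mathbf{u}_i\Vert=\max_i\Vert\lambda_i\mathbf{u}_i\Vert$ for all $\lambda_i\in\mathcal{K}$. A set $S\subseteq\mathcal{K}^n\setminus\{\mathbf0\}$ is $(k,\ell)$-orthogonal if every $E\subseteq S$ with $|E|=k$ contains an orthogonal subset of size $\ell$; $\Theta_n^{(k,\ell)}$ is the maximum size of a $(k,\ell)$-orthogonal subset of $\mathbb{B}_n$. -}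

module Defs where

open import Level using (Level; _⊔_) renaming (suc to lsuc)
open import Algebra.Bundles using (CommutativeRing)
open import Data.Integer as ℤ using (ℤ; +_)
open import Data.Nat using (ℕ; zero; suc)
import Data.Nat
open import Data.Fin using (Fin; zero; suc)
open import Data.Product using (Σ; ∃; _×_; _,_)
open import Function using (_∘_)
open import Function.Definitions using (Injective)
open import Relation.Binary.PropositionalEquality using (_≡_)
open import Relation.Nullary using (¬_)

data ℤ∞ : Set where
  fin : ℤ → ℤ∞
  ∞   : ℤ∞

infix 4 _≤∞_
data _≤∞_ : ℤ∞ → ℤ∞ → Set where
  fin≤fin : ∀ {a b} → a ℤ.≤ b → fin a ≤∞ fin b
  _≤∞∞    : ∀ x → x ≤∞ ∞

infixl 6 _+∞_
_+∞_ : ℤ∞ → ℤ∞ → ℤ∞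
fin a +∞ fin b = fin (a ℤ.+ b)
fin _ +∞ ∞     = ∞
∞     +∞ _     = ∞

min∞ : ℤ∞ → ℤ∞ → ℤ∞
min∞ (fin a) (fin b) = fin (a ℤ.⊓ b)
min∞ (fin a) ∞       = fin a
min∞ ∞       y       = y

minFin : ∀ {m} → (Fin m → ℤ∞) → ℤ∞
minFin {zero}  f = ∞
minFin {suc m} f = min∞ (f zero) (minFin (f ∘ suc))

record DiscreteValuedField (c ℓ : Level) : Set (lsuc (c ⊔ ℓ)) where
  field
    commRing : CommutativeRing c ℓ
  open CommutativeRing commRing public
  field
    1≉0     : ¬ (1# ≈ 0#)
    inverse : ∀ x → ¬ (x ≈ 0#) → ∃ λ y → (x * y) ≈ 1#
    ν        : Carrier → ℤ∞
    ν-cong   : ∀ {x y} → x ≈ y → ν x ≡ ν y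
    ν-∞      : ∀ x → ν x ≡ ∞ → x ≈ 0#
    ν-0      : ν 0# ≡ ∞
    ν-*      : ∀ x y → ν (x * y) ≡ ν x +∞ ν y
    ν-+      : ∀ x y → min∞ (ν x) (ν y) ≤∞ ν (x + y)
    ν-surj   : ∀ (z : ℤ) → ∃ λ x → ν x ≡ fin z
    -- finite residue field O/𝔪 with q elements, given by representatives
    q        : ℕ
    rep      : Fin q → Carrier
    rep-int  : ∀ i → fin (+ 0) ≤∞ ν (rep i)
    rep-cover : ∀ x → fin (+ 0) ≤∞ ν x → ∃ λ i → fin (+ 1) ≤∞ ν (x - rep i)
    rep-distinct : ∀ i j → fin (+ 1) ≤∞ ν (rep i - rep j) → i ≡ j

module _ {c ℓ} (K : DiscreteValuedField c ℓ) where
  open DiscreteValuedField K using (Carrier; _≈_; _+_; _*_; 0#; ν)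

  Vecᴷ : ℕ → Set c
  Vecᴷ n = Fin n → Carrier

  Σᵛ : ∀ {n m} → (Fin m → Vecᴷ n) → Vecᴷ n
  Σᵛ {m = zero}  f t = 0#
  Σᵛ {m = suc m} f t = f zero t + Σᵛ (f ∘ suc) t

  _·ᵛ_ : ∀ {n} → Carrier → Vecᴷ n → Vecᴷ n
  (a ·ᵛ v) t = a * v t

  -- ν‖v‖ := min_i ν(v_i), so that ‖v‖ = max_i |v_i| = q^(-ν‖v‖)
  ν‖_‖ : ∀ {n} → Vecᴷ n → ℤ∞
  ν‖ v ‖ = minFin (λ t → ν (v t))

  IsZeroVec : ∀ {n} → Vecᴷ n → Set ℓ
  IsZeroVec v = ∀ t → v t ≈ 0#

  InBall : ∀ {n} → Vecᴷ n → Set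
  InBall v = ν‖ v ‖ ≡ fin (+ 0)

  -- u_1..u_r orthogonal: nonzero, and ‖Σ λ_i u_i‖ = max_i ‖λ_i u_i‖
  -- (equivalently, since |·| = q^(-ν), ν‖Σ λ_i u_i‖ = min_i ν‖λ_i u_i‖)
  Orthogonal : ∀ {n r} → (Fin r → Vecᴷ n) → Set (c ⊔ ℓ)
  Orthogonal {r = r} u =
    (∀ i → ¬ IsZeroVec (u i)) ×
    (∀ (λs : Fin r → Carrier) →
       ν‖ Σᵛ (λ i → λs i ·ᵛ u i) ‖ ≡ minFin (λ i → ν‖ λs i ·ᵛ u i ‖))

  -- a finite set S of m distinct vectors, given as an injective family
  Distinct : ∀ {n m} → (Fin m → Vecᴷ n) → Set ℓ
  Distinct S = ∀ i j → (∀ t → S i t ≈ S j t) → i ≡ j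

  KLOrthogonal : ∀ {n m} → ℕ → ℕ → (Fin m → Vecᴷ n) → Set (c ⊔ ℓ)
  KLOrthogonal k l S =
    ∀ (e : Fin k → Fin _) → Injective _≡_ _≡_ e →
      ∃ λ (f : Fin l → Fin k) → Injective _≡_ _≡_ f × Orthogonal (S ∘ e ∘ f)

  Admissible : (n k l : ℕ) → ∀ {m} → (Fin m → Vecᴷ n) → Set (c ⊔ ℓ)
  Admissible n k l S = Distinct S × (∀ i → InBall (S i)) × KLOrthogonal k l S

  -- Θ_n^(k,l) = m : m is the maximum size of a (k,l)-orthogonal subset of B_n
  IsΘ : (n k l m : ℕ) → Set (c ⊔ ℓ)
  IsΘ n k l m =
    (∃ λ (S : Fin m → Vecᴷ n) → Admissible n k l S) ×
    (∀ {m'} (S : Fin m' → Vecᴷ n) → Admissible n k l S → m' Data.Nat.≤ m)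

-- If S is a maximum (k,l)-orthogonal subset of B_n, adjoin to it any unit vector v ∉ S.
-- Every (k+1)-subset of S ∪ {v} contains k elements of S, hence an orthogonal l-subset,
-- so S ∪ {v} is (k+1,l)-orthogonal and Θ_n^(k+1,l) > |S| = Θ_n^(k,l). For n ≥ 2 such a v
-- is (x, y, 0, …, 0) with ν x = 0 and ν y larger than every |ν| of a second coordinate in S.
module Submission where

open import Defs
open import Data.Nat using (ℕ; suc; _≤_; _<_)
open import Data.Nat as ℕ using (zero; s≤s)
import Data.Nat.Properties as ℕ
open import Data.Integer as ℤ using (+_)
open import Data.Fin using (Fin; zero; suc; punchIn; punchOut)
open import Data.Fin.Properties
  using (any?; suc-injective; punchIn-injective; punchInᵢ≢i; punchOut-injective; punchIn-punchOut)
  renaming (_≟_ to _≟ᶠ_)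
open import Data.Vec.Functional using (_∷_)
open import Data.Product using (∃; ∃₂; _×_; _,_; proj₁; proj₂)
open import Function using (_∘_)
open import Function.Definitions using (Injective)
open import Relation.Binary.PropositionalEquality
open import Relation.Nullary using (¬_; yes; no)
open import Data.Empty using (⊥-elim)

∣_∣∞ : ℤ∞ → ℕ
∣ fin a ∣∞ = ℤ.∣ a ∣
∣ ∞ ∣∞     = 0

minFin-cong : ∀ {m} {f g : Fin m → ℤ∞} → (∀ i → f i ≡ g i) → minFin f ≡ minFin g
minFin-cong {zero}  f≗g = refl
minFin-cong {suc m} f≗g = cong₂ min∞ (f≗g zero) (minFin-cong (f≗g ∘ suc))

minFin-∞ : ∀ {m} (f : Fin m → ℤ∞) → (∀ i → f i ≡ ∞) → minFin f ≡ ∞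
minFin-∞ {zero}  f f≡∞ = refl
minFin-∞ {suc m} f f≡∞ rewrite f≡∞ zero = minFin-∞ (f ∘ suc) (f≡∞ ∘ suc)

finite-family-bounded : ∀ {m} (f : Fin m → ℕ) → ∃ λ b → ∀ j → f j < b
finite-family-bounded {zero}  f = 0 , λ ()
finite-family-bounded {suc m} f with finite-family-bounded (f ∘ suc)
... | b , f∘suc<b = suc (f zero) ℕ.⊔ b , bound
  where
  bound : ∀ j → f j < suc (f zero) ℕ.⊔ b
  bound zero    = ℕ.m≤m⊔n (suc (f zero)) b
  bound (suc j) = ℕ.<-≤-trans (f∘suc<b j) (ℕ.m≤n⊔m (suc (f zero)) b)

fresh-valuation : ∀ {m} (f : Fin m → ℤ∞) → ∃ λ b → ∀ j → f j ≢ fin (+ b)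
fresh-valuation f with finite-family-bounded (∣_∣∞ ∘ f)
... | b , ∣f∣<b = b , λ j fj≡b → ℕ.<-irrefl (cong ∣_∣∞ fj≡b) (∣f∣<b j)

-- g skips the preimage of zero under e, if there is one.
injection-avoiding-zero : ∀ {k m} (e : Fin (suc k) → Fin (suc m)) → Injective _≡_ _≡_ e →
  ∃₂ λ (g : Fin k → Fin (suc k)) (e′ : Fin k → Fin m) →
    Injective _≡_ _≡_ g × Injective _≡_ _≡_ e′ × (∀ i → e (g i) ≡ suc (e′ i))
injection-avoiding-zero {k} {m} e e-inj = g , e′ , g-inj , e′-inj , e∘g≡suc∘e′
  where
  avoid : ∃ λ (g : Fin k → Fin (suc k)) → Injective _≡_ _≡_ g × (∀ i → zero ≢ e (g i))
  avoid with any? (λ i → e i ≟ᶠ zero)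
  ... | yes (p , ep≡0) = punchIn p , punchIn-injective p _ _ ,
                         λ i 0≡e → punchInᵢ≢i p i (e-inj (trans (sym 0≡e) (sym ep≡0)))
  ... | no ∄p          = suc , suc-injective , λ i 0≡e → ∄p (suc i , sym 0≡e)

  g : Fin k → Fin (suc k)
  g = proj₁ avoid

  g-inj : Injective _≡_ _≡_ g
  g-inj = proj₁ (proj₂ avoid)

  0≢e∘g : ∀ i → zero ≢ e (g i)
  0≢e∘g = proj₂ (proj₂ avoid)

  e′ : Fin k → Fin m
  e′ i = punchOut (0≢e∘g i)

  e′-inj : Injective _≡_ _≡_ e′
  e′-inj {i} {j} = g-inj ∘ e-inj ∘ punchOut-injective (0≢e∘g i) (0≢e∘g j)

  e∘g≡suc∘e′ : ∀ i → e (g i) ≡ suc (e′ i)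
  e∘g≡suc∘e′ i = sym (punchIn-punchOut (0≢e∘g i))

module _ {c ℓ} (K : DiscreteValuedField c ℓ) where
  open DiscreteValuedField K using (_≈_; _+_; 0#; ν; ν-cong; ν-0; ν-surj)
    renaming (sym to ≈-sym)

  Σᵛ-cong : ∀ {n m} {f g : Fin m → Vecᴷ K n} → (∀ i → f i ≡ g i) → ∀ t → Σᵛ K f t ≡ Σᵛ K g t
  Σᵛ-cong {m = zero}  f≗g t = refl
  Σᵛ-cong {m = suc m} f≗g t = cong₂ _+_ (cong (λ v → v t) (f≗g zero)) (Σᵛ-cong (f≗g ∘ suc) t)

  ν‖‖-cong : ∀ {n} {v w : Vecᴷ K n} → (∀ t → v t ≡ w t) → ν‖_‖ K v ≡ ν‖_‖ K w
  ν‖‖-cong v≗w = minFin-cong (cong ν ∘ v≗w)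

  Orthogonal-resp : ∀ {n r} {u u′ : Fin r → Vecᴷ K n} → (∀ i → u i ≡ u′ i) →
    Orthogonal K u → Orthogonal K u′
  Orthogonal-resp {u = u} {u′} u≗u′ (nonzero , ν-Σ) = nonzero′ , ν-Σ′
    where
    nonzero′ : ∀ i → ¬ IsZeroVec K (u′ i)
    nonzero′ i = nonzero i ∘ subst (IsZeroVec K) (sym (u≗u′ i))

    ν-Σ′ : ∀ λs → ν‖_‖ K (Σᵛ K (λ i → _·ᵛ_ K (λs i) (u′ i)))
                ≡ minFin (λ i → ν‖_‖ K (_·ᵛ_ K (λs i) (u′ i)))
    ν-Σ′ λs = begin
      ν‖_‖ K (Σᵛ K (λ i → _·ᵛ_ K (λs i) (u′ i)))
        ≡⟨ ν‖‖-cong (Σᵛ-cong (λ i → cong (_·ᵛ_ K (λs i)) (sym (u≗u′ i)))) ⟩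
      ν‖_‖ K (Σᵛ K (λ i → _·ᵛ_ K (λs i) (u i)))
        ≡⟨ ν-Σ λs ⟩
      minFin (λ i → ν‖_‖ K (_·ᵛ_ K (λs i) (u i)))
        ≡⟨ minFin-cong (λ i → cong (ν‖_‖ K ∘ _·ᵛ_ K (λs i)) (u≗u′ i)) ⟩
      minFin (λ i → ν‖_‖ K (_·ᵛ_ K (λs i) (u′ i))) ∎
      where open ≡-Reasoning

  KLOrthogonal-∷ : ∀ {n m k l} (v : Vecᴷ K n) (S : Fin m → Vecᴷ K n) →
    KLOrthogonal K k l S → KLOrthogonal K (suc k) l (v ∷ S)
  KLOrthogonal-∷ v S S-orth e e-inj
    with injection-avoiding-zero e e-inj
  ... | g , e′ , g-inj , e′-inj , e∘g≡suc∘e′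
    with S-orth e′ e′-inj
  ... | f , f-inj , orth =
    g ∘ f , f-inj ∘ g-inj ,
    Orthogonal-resp (λ i → sym (cong (v ∷ S) (e∘g≡suc∘e′ (f i)))) orth

  Distinct-∷ : ∀ {n m} {v : Vecᴷ K n} {S : Fin m → Vecᴷ K n} →
    (∀ j → ¬ (∀ t → v t ≈ S j t)) → Distinct K S → Distinct K (v ∷ S)
  Distinct-∷ v∉S S-dist zero    zero    _   = refl
  Distinct-∷ v∉S S-dist zero    (suc j) v≈S = ⊥-elim (v∉S j v≈S)
  Distinct-∷ v∉S S-dist (suc i) zero    S≈v = ⊥-elim (v∉S i (≈-sym ∘ S≈v))
  Distinct-∷ v∉S S-dist (suc i) (suc j) S≈S = cong suc (S-dist i j S≈S)

  Admissible-∷ : ∀ {n m k l} {v : Vecᴷ K n} {S : Fin m → Vecᴷ K n} →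
    InBall K v → (∀ j → ¬ (∀ t → v t ≈ S j t)) →
    Admissible K n k l S → Admissible K n (suc k) l (v ∷ S)
  Admissible-∷ {v = v} {S} v∈B v∉S (S-dist , S⊆B , S-orth) =
    Distinct-∷ v∉S S-dist , (λ { zero → v∈B ; (suc i) → S⊆B i }) , KLOrthogonal-∷ v S S-orth

  unit-vector-avoiding : ∀ {n m} → 2 ≤ n → (S : Fin m → Vecᴷ K n) →
    ∃ λ v → InBall K v × (∀ j → ¬ (∀ t → v t ≈ S j t))
  unit-vector-avoiding {suc (suc n)} (s≤s (s≤s _)) S = v , v∈B , v∉S
    where
    x = ν-surj (+ 0)
    b = fresh-valuation (λ j → ν (S j (suc zero)))
    y = ν-surj (+ proj₁ b)

    v : Vecᴷ K (suc (suc n))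
    v zero          = proj₁ x
    v (suc zero)    = proj₁ y
    v (suc (suc _)) = 0#

    v∈B : InBall K v
    v∈B rewrite proj₂ x | proj₂ y | minFin-∞ (λ t → ν (v (suc (suc t)))) (λ _ → ν-0) = refl

    v∉S : ∀ j → ¬ (∀ t → v t ≈ S j t)
    v∉S j v≈S = proj₂ b j (trans (sym (ν-cong (v≈S (suc zero)))) (proj₂ y))

lemma2p3 : ∀ {c ℓ'} (K : DiscreteValuedField c ℓ') (n l : ℕ) → 2 ≤ l → l ≤ n →
    ∀ (k m m' : ℕ) → l ≤ k → IsΘ K n k l m → IsΘ K n (suc k) l m' → m < m'
lemma2p3 K n l 2≤l l≤n k m m' _ ((S , S-adm) , _) (_ , Θ-maximal)
  with unit-vector-avoiding K (ℕ.≤-trans 2≤l l≤n) S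
... | v , v∈B , v∉S = Θ-maximal (v ∷ S) (Admissible-∷ K v∈B v∉S S-adm)
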